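{- Let $n\ge 3$. Among all connected graphs on $n$ vertices with dissociation number $2$, the unique graph with the minimum number of edges is the cocktail party graph $CP_n$ if $n$ is even, and the odd cocktail party graph $L_n$ if $n$ is odd.
   Context: For even $d$, $CP_d$ is the complement of a perfect matching in $K_d$; for odd $d$, $L_d=CP_{d-1}\vee K_1$ (join with a single vertex). A dissociation set of $G$ is a vertex set inducing a subgraph of maximum degree at most $1$; the dissociation number $\tau(G)$ is the largest size of a dissociation set. -}

module Defs where

open import Data.Bool using (Bool; true; false; not; _∧_; if_then_else_)
open import Data.Nat using (ℕ; zero; suc; _+_; _*_; _≤_; _<ᵇ_; _≡ᵇ_; _/_)
open import Data.Fin using (Fin; toℕ) renaming (zero to fz; suc to fs)
open import Data.List using (List; map)
open import Data.Nat.ListAction using (sum)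
open import Data.List using () renaming (allFin to allFinL)
open import Data.Product using (Σ; Σ-syntax; _×_; _,_; ∃-syntax)
open import Function.Bundles using (_↔_; Inverse)
open import Relation.Binary.PropositionalEquality using (_≡_; refl)

record Graph (n : ℕ) : Set where
  field
    adj    : Fin n → Fin n → Bool
    sym    : ∀ i j → adj i j ≡ adj j i
    irrefl : ∀ i → adj i i ≡ false
open Graph public

sumFin : (n : ℕ) → (Fin n → ℕ) → ℕ
sumFin n f = sum (map f (allFinL n))

b2n : Bool → ℕ
b2n true  = 1
b2n false = 0

edges : ∀ {n} → Graph n → ℕ
edges {n} G = sumFin n λ i → sumFin n λ j → b2n ((toℕ i <ᵇ toℕ j) ∧ adj G i j)

data Walk {n : ℕ} (G : Graph n) : Fin n → Fin n → Set where
  here : ∀ {u} → Walk G u u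
  step : ∀ {u v w} → adj G u v ≡ true → Walk G v w → Walk G u w

Connected : ∀ {n} → Graph n → Set
Connected {n} G = ∀ (u v : Fin n) → Walk G u v

Subset : ℕ → Set
Subset n = Fin n → Bool

size : ∀ {n} → Subset n → ℕ
size {n} S = sumFin n λ i → b2n (S i)

IsDissociationSet : ∀ {n} → Graph n → Subset n → Set
IsDissociationSet {n} G S =
  ∀ v → S v ≡ true → sumFin n (λ u → b2n (S u ∧ adj G v u)) ≤ 1

DissociationNumber : ∀ {n} → Graph n → ℕ → Set
DissociationNumber {n} G k =
  (Σ[ S ∈ Subset n ] (IsDissociationSet G S × size S ≡ k))
  × (∀ (S : Subset n) → IsDissociationSet G S → size S ≤ k)

_≅_ : ∀ {n} → Graph n → Graph n → Set
_≅_ {n} G H = Σ[ f ∈ Fin n ↔ Fin n ] (∀ i j → adj G i j ≡ adj H (Inverse.to f i) (Inverse.to f j))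

≡ᵇ-sym : ∀ a b → (a ≡ᵇ b) ≡ (b ≡ᵇ a)
≡ᵇ-sym zero zero = refl
≡ᵇ-sym zero (suc b) = refl
≡ᵇ-sym (suc a) zero = refl
≡ᵇ-sym (suc a) (suc b) = ≡ᵇ-sym a b

≡ᵇ-refl : ∀ a → (a ≡ᵇ a) ≡ true
≡ᵇ-refl zero = refl
≡ᵇ-refl (suc a) = ≡ᵇ-refl a

notcong : ∀ {a b : Bool} → a ≡ b → not a ≡ not b
notcong refl = refl

-- Cocktail party graph CP_d (d even): complement in K_d of the perfect matching
-- {0,1},{2,3},...,{d-2,d-1}; i.e. i ~ j iff ⌊i/2⌋ ≠ ⌊j/2⌋.
CP : (d : ℕ) → Graph d
CP d = record
  { adj    = λ i j → not ((toℕ i / 2) ≡ᵇ (toℕ j / 2))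
  ; sym    = λ i j → notcong (≡ᵇ-sym (toℕ i / 2) (toℕ j / 2))
  ; irrefl = λ i → notcong (≡ᵇ-refl (toℕ i / 2))
  }

joinK1 : ∀ {m} → Graph m → Graph (suc m)
joinK1 {m} G = record { adj = a ; sym = s ; irrefl = r }
  where
  a : Fin (suc m) → Fin (suc m) → Bool
  a fz fz = false
  a fz (fs j) = true
  a (fs i) fz = true
  a (fs i) (fs j) = adj G i j
  s : ∀ i j → a i j ≡ a j i
  s fz fz = refl
  s fz (fs j) = refl
  s (fs i) fz = refl
  s (fs i) (fs j) = sym G i j
  r : ∀ i → a i i ≡ false
  r fz = refl
  r (fs i) = irrefl G i

-- Odd cocktail party graph L_d = CP_{d-1} ∨ K_1 (d odd, d = suc d')
L : (d : ℕ) → Graph d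
L zero = CP zero
L (suc d') = joinK1 (CP d')

UniqueMinimizer : ∀ {n} → Graph n → Set
UniqueMinimizer {n} H =
  Connected H × DissociationNumber H 2 ×
  (∀ (G : Graph n) → Connected G → DissociationNumber G 2 →
     (edges H ≤ edges G) × (edges G ≡ edges H → G ≅ H))

-- For n ≥ 3, τ(G) = 2 exactly when every vertex has at most one non-neighbour other than itself,
-- i.e. when the complement of G is a matching: a vertex with two non-neighbours spans, with them, a
-- dissociation set of size 3, and conversely no three vertices of such a graph form a dissociation set. If the complementary matching has m edges and leaves u vertices
-- unmatched, then |E(G)| + m is the number of pairs of vertices and u + 2m = n, so |E(G)| is least
-- exactly when u ≤ 1, that is u = n mod 2. A graph whose complement is a perfect (u = 0) or
-- near-perfect (u = 1) matching is CP_n, respectively L_n: number the non-edges and send the ends of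
-- the k-th one to 2k and 2k + 1, and the unmatched vertex to the apex of L_n.

module Submission where

open import Defs hiding (sym)
open import Data.Bool using (Bool; true; false; not; _∧_; _∨_; if_then_else_)
open import Data.Bool.Properties
  using (¬-not; not-¬; not-involutive; ∧-zeroʳ; ∧-identityʳ; ∧-conicalˡ; ∧-conicalʳ; T-≡)
  renaming (_≟_ to _≟ᵇ_)
open import Data.Empty using (⊥; ⊥-elim)
open import Data.Fin using (Fin; toℕ; fromℕ<; punchOut) renaming (zero to fz; suc to fs)
open import Data.Fin.Properties
  using (_≟_; any?; toℕ-injective; toℕ-fromℕ<; toℕ<n; suc-injective; injective⇒≤; punchOut-injective)
open import Data.List.Properties using (map-tabulate)
open import Data.Nat using (ℕ; zero; suc; _+_; _*_; _∸_; _≤_; _<_; _<ᵇ_; z≤n; s≤s; _/_; _%_)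
open import Data.Nat.DivMod
  using ( m≡m%n+[m/n]*n; m%n<n; m<n*o⇒m/o<n; m*n/n≡m; m<n⇒m/n≡0; +-distrib-/-∣ʳ
        ; [m+kn]%n≡m%n; m<n⇒m%n≡m)
open import Data.Nat.Divisibility using (divides-refl)
open import Data.Nat.ListAction using (sum)
open import Data.Nat.Properties as ℕ
  using ( +-0-commutativeMonoid; ≤-refl; ≤-trans; ≤-reflexive; <-cmp; <-irrefl; <-trans; ≰⇒>
        ; m≤n+m; m∸n≤m
        ; +-identityʳ; *-identityʳ; *-zeroʳ; *-comm; +-mono-≤; +-monoʳ-≤; +-monoˡ-<; *-monoˡ-≤
        ; +-cancelʳ-≤; +-cancelˡ-≡; +-cancelʳ-≡; <ᵇ-reflects-<; <ᵇ⇒<)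
open import Algebra.Properties.CommutativeMonoid.Sum +-0-commutativeMonoid
  using (∑-distrib-+; ∑-comm; sum-cong-≗) renaming (sum to ∑)
open import Data.Product using (∃; _×_; _,_; proj₁; proj₂)
open import Data.Sum using (_⊎_; inj₁; inj₂)
open import Function using (_∘_; id)
open import Function.Bundles using (Equivalence; mk↔ₛ′)
open import Relation.Binary.Definitions using (tri<; tri≈; tri>)
open import Relation.Binary.PropositionalEquality
  using (_≡_; _≢_; refl; sym; trans; cong; cong₂; subst; module ≡-Reasoning)
open import Relation.Nullary using (Dec; yes; no; does; _because_)
open import Relation.Nullary.Decidable using (dec-true; dec-false; ¬?; _×-dec_)

open ≡-Reasoning

private variable n : ℕ

sumFin-suc : ∀ n (f : Fin (suc n) → ℕ) → sumFin (suc n) f ≡ f fz + sumFin n (f ∘ fs)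
sumFin-suc n f = cong (λ xs → f fz + sum xs) (trans (map-tabulate fs f) (sym (map-tabulate id (f ∘ fs))))

sumFin≡∑ : ∀ n (f : Fin n → ℕ) → sumFin n f ≡ ∑ f
sumFin≡∑ zero f = refl
sumFin≡∑ (suc n) f = trans (sumFin-suc n f) (cong (f fz +_) (sumFin≡∑ n (f ∘ fs)))

sumFin-cong : ∀ n {f g : Fin n → ℕ} → (∀ i → f i ≡ g i) → sumFin n f ≡ sumFin n g
sumFin-cong n {f} {g} f≗g = trans (sumFin≡∑ n f) (trans (sum-cong-≗ f≗g) (sym (sumFin≡∑ n g)))

sumFin-distrib-+ : ∀ n (f g : Fin n → ℕ) → sumFin n (λ i → f i + g i) ≡ sumFin n f + sumFin n g
sumFin-distrib-+ n f g = trans (sumFin≡∑ n _)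
  (trans (∑-distrib-+ f g) (sym (cong₂ _+_ (sumFin≡∑ n f) (sumFin≡∑ n g))))

sumFin-comm : ∀ m n (f : Fin m → Fin n → ℕ) →
  sumFin m (λ i → sumFin n (f i)) ≡ sumFin n (λ j → sumFin m (λ i → f i j))
sumFin-comm m n f = trans (trans (sumFin-cong m (λ i → sumFin≡∑ n (f i))) (sumFin≡∑ m _))
  (trans (∑-comm f) (sym (trans (sumFin-cong n (λ j → sumFin≡∑ m (λ i → f i j))) (sumFin≡∑ n _))))

sumFin-const : ∀ n c → sumFin n (λ _ → c) ≡ n * c
sumFin-const zero c = refl
sumFin-const (suc n) c = trans (sumFin-suc n (λ _ → c)) (cong (c +_) (sumFin-const n c))

sumFin-mono : ∀ n {f g : Fin n → ℕ} → (∀ i → f i ≤ g i) → sumFin n f ≤ sumFin n g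
sumFin-mono zero f≤g = z≤n
sumFin-mono (suc n) {f} {g} f≤g rewrite sumFin-suc n f | sumFin-suc n g =
  +-mono-≤ (f≤g fz) (sumFin-mono n (f≤g ∘ fs))

sumFin-single : ∀ n {f : Fin n → ℕ} p → (∀ i → i ≢ p → f i ≡ 0) → sumFin n f ≡ f p
sumFin-single (suc n) {f} fz f≡0 = begin
  sumFin (suc n) f                 ≡⟨ sumFin-suc n f ⟩
  f fz + sumFin n (f ∘ fs)         ≡⟨ cong (f fz +_) (sumFin-cong n (λ i → f≡0 (fs i) λ ())) ⟩
  f fz + sumFin n (λ _ → 0)        ≡⟨ cong (f fz +_) (trans (sumFin-const n 0) (*-zeroʳ n)) ⟩
  f fz + 0                         ≡⟨ +-identityʳ (f fz) ⟩
  f fz                             ∎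
sumFin-single (suc n) {f} (fs p) f≡0 = trans (sumFin-suc n f)
  (cong₂ _+_ (f≡0 fz λ ()) (sumFin-single n p λ i i≢p → f≡0 (fs i) (i≢p ∘ suc-injective)))

∅ : Subset n
∅ _ = false

insert : Fin n → Subset n → Subset n
insert p S k = does (p ≟ k) ∨ S k

⁅_⁆ : Fin n → Subset n
⁅ p ⁆ = insert p ∅

pair : Fin n → Fin n → Subset n
pair y z = insert y ⁅ z ⁆

_⊆_ : Subset n → Subset n → Set
S ⊆ T = ∀ k → S k ≡ true → T k ≡ true

insert-∈ : ∀ p (S : Subset n) → insert p S p ≡ true
insert-∈ p S = cong (_∨ S p) (dec-true (p ≟ p) refl)

∈-insert⁺ : ∀ p (S : Subset n) {k} → S k ≡ true → insert p S k ≡ true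
∈-insert⁺ p S {k} Sk with does (p ≟ k)
... | true = refl
... | false = Sk

∈-insert⁻ : ∀ p (S : Subset n) {k} → insert p S k ≡ true → p ≡ k ⊎ S k ≡ true
∈-insert⁻ p S {k} e with p ≟ k
... | yes p≡k = inj₁ p≡k
... | no _ = inj₂ e

∈-pair⁻ : ∀ (y z : Fin n) {k} → pair y z k ≡ true → y ≡ k ⊎ z ≡ k
∈-pair⁻ y z k∈ with ∈-insert⁻ y ⁅ z ⁆ k∈
... | inj₁ y≡k = inj₁ y≡k
... | inj₂ k∈z with ∈-insert⁻ z ∅ k∈z
... | inj₁ z≡k = inj₂ z≡k

size-empty : (S : Subset n) → (∀ k → S k ≡ false) → size S ≡ 0
size-empty {n} S S≡false = trans (sumFin-cong n (cong b2n ∘ S≡false)) (trans (sumFin-const n 0) (*-zeroʳ n))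

size-mono : {S T : Subset n} → S ⊆ T → size S ≤ size T
size-mono {n} {S} {T} S⊆T = sumFin-mono n pointwise
  where
  pointwise : ∀ k → b2n (S k) ≤ b2n (T k)
  pointwise k with S k in Sk
  ... | false = z≤n
  ... | true rewrite S⊆T k Sk = ≤-refl

size-indicator : ∀ (p : Fin n) → size (⁅ p ⁆) ≡ 1
size-indicator {n} p = trans (sumFin-single n p off-p) (cong b2n (insert-∈ p ∅))
  where
  off-p : ∀ k → k ≢ p → b2n (⁅ p ⁆ k) ≡ 0
  off-p k k≢p = cong (λ b → b2n (b ∨ false)) (dec-false (p ≟ k) (k≢p ∘ sym))

size-insert-≤ : ∀ p (S : Subset n) → size (insert p S) ≤ suc (size S)
size-insert-≤ {n} p S = ≤-trans (sumFin-mono n pointwise)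
  (≤-reflexive (trans (sumFin-distrib-+ n _ _) (cong (_+ size S) (size-indicator p))))
  where
  pointwise : ∀ k → b2n (insert p S k) ≤ b2n (⁅ p ⁆ k) + b2n (S k)
  pointwise k with does (p ≟ k)
  ... | true = s≤s z≤n
  ... | false = ≤-refl

size-insert : ∀ p (S : Subset n) → S p ≡ false → size (insert p S) ≡ suc (size S)
size-insert {n} p S Sp = trans (sumFin-cong n pointwise)
  (trans (sumFin-distrib-+ n _ _) (cong (_+ size S) (size-indicator p)))
  where
  pointwise : ∀ k → b2n (insert p S k) ≡ b2n (⁅ p ⁆ k) + b2n (S k)
  pointwise k with p ≟ k
  ... | yes refl rewrite Sp = refl
  ... | no _ = refl

size-≤1 : ∀ (S : Subset n) p → (∀ k → S k ≡ true → k ≡ p) → size S ≤ 1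
size-≤1 S p S⊆p = ≤-trans (size-mono S⊆⁅p⁆) (≤-reflexive (size-indicator p))
  where
  S⊆⁅p⁆ : S ⊆ ⁅ p ⁆
  S⊆⁅p⁆ k Sk rewrite S⊆p k Sk = insert-∈ p ∅

size-≤2 : ∀ (S : Subset n) y z → (∀ k → S k ≡ true → y ≡ k ⊎ z ≡ k) → size S ≤ 2
size-≤2 S y z S⊆yz = ≤-trans (size-mono {S = S} (λ k → ∈-pair⁺ ∘ S⊆yz k))
  (≤-trans (size-insert-≤ y _) (s≤s (≤-reflexive (size-indicator z))))
  where
  ∈-pair⁺ : ∀ {k} → y ≡ k ⊎ z ≡ k → pair y z k ≡ true
  ∈-pair⁺ (inj₁ refl) = insert-∈ y ⁅ z ⁆
  ∈-pair⁺ (inj₂ refl) = ∈-insert⁺ y ⁅ z ⁆ (insert-∈ z ∅)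

size-pair : ∀ {y z : Fin n} → y ≢ z → size (pair y z) ≡ 2
size-pair {y = y} {z} y≢z = trans (size-insert y _ (cong (_∨ false) (dec-false (z ≟ y) (y≢z ∘ sym))))
  (cong suc (size-indicator z))

size-triple : ∀ {i j k : Fin n} → i ≢ j → i ≢ k → j ≢ k → size (insert i (pair j k)) ≡ 3
size-triple {i = i} {j} {k} i≢j i≢k j≢k = trans (size-insert i (pair j k) i∉jk) (cong suc (size-pair j≢k))
  where
  i∉jk : pair j k i ≡ false
  i∉jk rewrite dec-false (j ≟ i) (i≢j ∘ sym) | dec-false (k ≟ i) (i≢k ∘ sym) = refl

member⇒1≤size : ∀ (S : Subset n) {y} → S y ≡ true → 1 ≤ size S
member⇒1≤size S {y} Sy = ≤-trans (≤-reflexive (sym (size-indicator y))) (size-mono {S = ⁅ y ⁆} ⁅y⁆⊆S)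
  where
  ⁅y⁆⊆S : ⁅ y ⁆ ⊆ S
  ⁅y⁆⊆S k k∈ with ∈-insert⁻ y ∅ k∈
  ... | inj₁ refl = Sy

two-members⇒2≤size : ∀ (S : Subset n) {y z} → y ≢ z → S y ≡ true → S z ≡ true → 2 ≤ size S
two-members⇒2≤size S {y} {z} y≢z Sy Sz =
  ≤-trans (≤-reflexive (sym (size-pair y≢z))) (size-mono {S = pair y z} pair⊆S)
  where
  pair⊆S : pair y z ⊆ S
  pair⊆S k k∈ with ∈-pair⁻ y z k∈
  ... | inj₁ refl = Sy
  ... | inj₂ refl = Sz

third-vertex : 3 ≤ n → (u v : Fin n) → ∃ λ w → u ≢ w × v ≢ w
third-vertex {n} 3≤n u v with any? (λ w → ¬? (u ≟ w) ×-dec ¬? (v ≟ w))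
... | yes third = third
... | no none with ≤-trans 3≤n (≤-trans (≤-reflexive size-all) (size-≤2 (λ _ → true) u v members))
  where
  size-all : n ≡ size {n} (λ _ → true)
  size-all = sym (trans (sumFin-const n 1) (*-identityʳ n))
  members : ∀ k → true ≡ true → u ≡ k ⊎ v ≡ k
  members k _ with u ≟ k | v ≟ k
  ... | yes u≡k | _ = inj₁ u≡k
  ... | no _ | yes v≡k = inj₂ v≡k
  ... | no u≢k | no v≢k = ⊥-elim (none (k , u≢k , v≢k))
... | s≤s (s≤s ())

[b+q*2]/2≡q : ∀ b q → b < 2 → (b + q * 2) / 2 ≡ q
[b+q*2]/2≡q b q b<2 = begin
  (b + q * 2) / 2     ≡⟨ +-distrib-/-∣ʳ b (divides-refl q) ⟩
  b / 2 + q * 2 / 2   ≡⟨ cong₂ _+_ (m<n⇒m/n≡0 b<2) (m*n/n≡m q 2) ⟩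
  q                   ∎

[b+q*2]%2≡b : ∀ b q → b < 2 → (b + q * 2) % 2 ≡ b
[b+q*2]%2≡b b q b<2 = trans ([m+kn]%n≡m%n b q 2) (m<n⇒m%n≡m b<2)

b+q*2<k*2 : ∀ {b q k} → b < 2 → q < k → b + q * 2 < k * 2
b+q*2<k*2 {b} {q} {k} b<2 q<k = ≤-trans (+-monoˡ-< (q * 2) b<2) (*-monoˡ-≤ 2 q<k)

≡-by-/2-%2 : ∀ {x y} → x / 2 ≡ y / 2 → x % 2 ≡ y % 2 → x ≡ y
≡-by-/2-%2 {x} {y} x/2≡y/2 x%2≡y%2 = begin
  x                   ≡⟨ m≡m%n+[m/n]*n x 2 ⟩
  x % 2 + x / 2 * 2   ≡⟨ cong₂ (λ r q → r + q * 2) x%2≡y%2 x/2≡y/2 ⟩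
  y % 2 + y / 2 * 2   ≡⟨ m≡m%n+[m/n]*n y 2 ⟨
  y                   ∎

-- Its decision is literally the test toℕ i <ᵇ toℕ j used in edges.
_<?ᶠ_ : (i j : Fin n) → Dec (toℕ i < toℕ j)
i <?ᶠ j = (toℕ i <ᵇ toℕ j) because <ᵇ-reflects-< (toℕ i) (toℕ j)

<ᵇ-true⇒< : ∀ {i j : Fin n} → (toℕ i <ᵇ toℕ j) ≡ true → toℕ i < toℕ j
<ᵇ-true⇒< e = <ᵇ⇒< _ _ (Equivalence.from T-≡ e)

nonEdges : Graph n → ℕ
nonEdges {n} G = sumFin n λ i → sumFin n λ j → b2n ((toℕ i <ᵇ toℕ j) ∧ not (adj G i j))

increasingPairs : ℕ → ℕ
increasingPairs n = sumFin n λ (i : Fin n) → sumFin n λ (j : Fin n) → b2n (toℕ i <ᵇ toℕ j)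

edges+nonEdges : (G : Graph n) → edges G + nonEdges G ≡ increasingPairs n
edges+nonEdges {n} G = trans (sym (sumFin-distrib-+ n _ _))
  (sumFin-cong n λ i → trans (sym (sumFin-distrib-+ n _ _))
    (sumFin-cong n λ j → split (toℕ i <ᵇ toℕ j) (adj G i j)))
  where
  split : ∀ c a → b2n (c ∧ a) + b2n (c ∧ not a) ≡ b2n c
  split false _ = refl
  split true true = refl
  split true false = refl

NonNeighbour : Graph n → Fin n → Fin n → Set
NonNeighbour G i k = i ≢ k × adj G i k ≡ false

nonNeighbour? : (G : Graph n) → ∀ i k → Dec (NonNeighbour G i k)
nonNeighbour? G i k = ¬? (i ≟ k) ×-dec (adj G i k ≟ᵇ false)

partner : Graph n → Fin n → Fin n
partner G i with any? (nonNeighbour? G i)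
... | yes (k , _) = k
... | no _ = i

partner-nonadjacent : (G : Graph n) → ∀ i → adj G i (partner G i) ≡ false
partner-nonadjacent G i with any? (nonNeighbour? G i)
... | yes (_ , _ , ik) = ik
... | no _ = irrefl G i

nonNeighbour⇒partner≢ : (G : Graph n) → ∀ {i k} → NonNeighbour G i k → i ≢ partner G i
nonNeighbour⇒partner≢ G {i} {k} ik with any? (nonNeighbour? G i)
... | yes (_ , i≢p , _) = i≢p
... | no none = ⊥-elim (none (k , ik))

adjacent-all⇒partner≡ : (G : Graph n) → ∀ {i} → (∀ k → i ≢ k → adj G i k ≡ true) →
  partner G i ≡ i
adjacent-all⇒partner≡ G {i} all with any? (nonNeighbour? G i)
... | yes (k , i≢k , ik) with () ← trans (sym (all k i≢k)) ik
... | no _ = refl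

order-count : ∀ (i p : Fin n) →
  b2n (does (p ≟ i)) + (b2n (toℕ i <ᵇ toℕ p) + b2n (toℕ p <ᵇ toℕ i)) ≡ 1
order-count i p with <-cmp (toℕ i) (toℕ p)
... | tri< i<p i≢p p≮i rewrite dec-true (i <?ᶠ p) i<p | dec-false (p <?ᶠ i) p≮i
  | dec-false (p ≟ i) (i≢p ∘ cong toℕ ∘ sym) = refl
... | tri≈ i≮p i≡p p≮i rewrite dec-false (i <?ᶠ p) i≮p | dec-false (p <?ᶠ i) p≮i
  | dec-true (p ≟ i) (toℕ-injective (sym i≡p)) = refl
... | tri> i≮p i≢p p<i rewrite dec-false (i <?ᶠ p) i≮p | dec-true (p <?ᶠ i) p<i
  | dec-false (p ≟ i) (i≢p ∘ cong toℕ ∘ sym) = refl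

isUnmatched : Graph n → Subset n
isUnmatched G i = does (partner G i ≟ i)

unmatched : Graph n → ℕ
unmatched G = size (isUnmatched G)

nonNeighbour⇒matched : (G : Graph n) → ∀ {i} → ∃ (NonNeighbour G i) → isUnmatched G i ≡ false
nonNeighbour⇒matched G (_ , ik) = dec-false (_ ≟ _) (nonNeighbour⇒partner≢ G ik ∘ sym)

all-nonNeighbour⇒unmatched≡0 : (G : Graph n) → (∀ i → ∃ (NonNeighbour G i)) → unmatched G ≡ 0
all-nonNeighbour⇒unmatched≡0 G has = size-empty (isUnmatched G) (nonNeighbour⇒matched G ∘ has)

partner≡⇒1≤unmatched : (G : Graph n) → ∀ {i} → partner G i ≡ i → 1 ≤ unmatched G
partner≡⇒1≤unmatched G {i} pi≡i = member⇒1≤size (isUnmatched G) (dec-true (partner G i ≟ i) pi≡i)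

1≤unmatched⇒partner≡ : (G : Graph n) → 1 ≤ unmatched G → ∃ λ c → partner G c ≡ c
1≤unmatched⇒partner≡ G 1≤u with any? (λ c → partner G c ≟ c)
... | yes found = found
... | no none
  with subst (1 ≤_) (size-empty (isUnmatched G) (λ c → dec-false (partner G c ≟ c) (none ∘ (c ,_)))) 1≤u
... | ()

unmatched≡1⇒unique : (G : Graph n) → unmatched G ≡ 1 →
  ∀ {i j} → partner G i ≡ i → partner G j ≡ j → i ≡ j
unmatched≡1⇒unique G one {i} {j} pi≡i pj≡j with i ≟ j
... | yes i≡j = i≡j
... | no i≢j with subst (2 ≤_) one
  (two-members⇒2≤size (isUnmatched G) i≢j
    (dec-true (partner G i ≟ i) pi≡i) (dec-true (partner G j ≟ j) pj≡j))
... | s≤s ()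

lowerEnd upperEnd : Graph n → Subset n
lowerEnd G i = toℕ i <ᵇ toℕ (partner G i)
upperEnd G i = toℕ (partner G i) <ᵇ toℕ i

IsCoMatching : Graph n → Set
IsCoMatching G = ∀ {i j k} → i ≢ j → i ≢ k → adj G i j ≡ false → adj G i k ≡ false → j ≡ k

module CoMatchingProperties (G : Graph n) (coMatching : IsCoMatching G) where

  nonadjacent⇒partner : ∀ {i k} → i ≢ k → adj G i k ≡ false → k ≡ partner G i
  nonadjacent⇒partner {i} {k} i≢k ik with any? (nonNeighbour? G i)
  ... | yes (p , i≢p , ip) = coMatching i≢k i≢p ik ip
  ... | no none = ⊥-elim (none (k , i≢k , ik))

  adjacent : ∀ {i k} → i ≢ k → k ≢ partner G i → adj G i k ≡ true
  adjacent i≢k k≢p = ¬-not (k≢p ∘ nonadjacent⇒partner i≢k)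

  partner-involutive : ∀ i → partner G (partner G i) ≡ i
  partner-involutive i with partner G i ≟ i
  ... | yes p≡i = trans (cong (partner G) p≡i) p≡i
  ... | no p≢i = sym (nonadjacent⇒partner p≢i (trans (Graph.sym G _ i) (partner-nonadjacent G i)))

  sum-nonadjacent : ∀ i (c : Fin n → Bool) → c i ≡ false →
    sumFin n (λ j → b2n (c j ∧ not (adj G i j))) ≡ b2n (c (partner G i))
  sum-nonadjacent i c ci = trans (sumFin-single n (partner G i) off-partner)
    (trans (cong (λ a → b2n (c (partner G i) ∧ not a)) (partner-nonadjacent G i)) (cong b2n (∧-identityʳ _)))
    where
    off-partner : ∀ j → j ≢ partner G i → b2n (c j ∧ not (adj G i j)) ≡ 0
    off-partner j j≢p with i ≟ j
    ... | yes refl rewrite ci = refl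
    ... | no i≢j rewrite adjacent i≢j j≢p = cong b2n (∧-zeroʳ (c j))

  nonEdges≡size-lowerEnd : nonEdges G ≡ size (lowerEnd G)
  nonEdges≡size-lowerEnd = sumFin-cong n λ i →
    sum-nonadjacent i (λ j → toℕ i <ᵇ toℕ j) (dec-false (i <?ᶠ i) (<-irrefl refl))

  nonEdges≡size-upperEnd : nonEdges G ≡ size (upperEnd G)
  nonEdges≡size-upperEnd = trans (sumFin-comm n n _) (sumFin-cong n λ j →
    trans (sumFin-cong n λ i → cong (λ a → b2n ((toℕ i <ᵇ toℕ j) ∧ not a)) (Graph.sym G i j))
          (sum-nonadjacent j (λ i → toℕ i <ᵇ toℕ j) (dec-false (j <?ᶠ j) (<-irrefl refl))))

  -- Every vertex is unmatched, or the lower end, or the upper end of exactly one non-edge.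
  unmatched+nonEdges*2 : unmatched G + nonEdges G * 2 ≡ n
  unmatched+nonEdges*2 = begin
    unmatched G + nonEdges G * 2
      ≡⟨ cong (unmatched G +_) (trans (*-comm (nonEdges G) 2) (cong (nonEdges G +_) (+-identityʳ _))) ⟩
    unmatched G + (nonEdges G + nonEdges G)
      ≡⟨ cong₂ (λ a b → unmatched G + (a + b)) nonEdges≡size-lowerEnd nonEdges≡size-upperEnd ⟩
    unmatched G + (size (lowerEnd G) + size (upperEnd G))
      ≡⟨ cong (unmatched G +_) (sumFin-distrib-+ n _ _) ⟨
    unmatched G + sumFin n (λ i → b2n (lowerEnd G i) + b2n (upperEnd G i))
      ≡⟨ sumFin-distrib-+ n _ _ ⟨
    sumFin n (λ i → b2n (isUnmatched G i) + (b2n (lowerEnd G i) + b2n (upperEnd G i)))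
      ≡⟨ sumFin-cong n (λ i → order-count i (partner G i)) ⟩
    sumFin n (λ _ → 1)
      ≡⟨ trans (sumFin-const n 1) (*-identityʳ n) ⟩
    n ∎

-- Dissociation number two

module _ (G : Graph n) where

  induced-degree≤1 : ∀ (S : Subset n) x p → (∀ k → S k ≡ true → adj G x k ≡ true → k ≡ p) →
    sumFin n (λ k → b2n (S k ∧ adj G x k)) ≤ 1
  induced-degree≤1 S x p onlyP = size-≤1 (λ k → S k ∧ adj G x k) p
    (λ k e → onlyP k (∧-conicalˡ _ _ e) (∧-conicalʳ _ _ e))

  self-loop : ∀ {x} → adj G x x ≡ true → ⊥
  self-loop {x} xx with () ← trans (sym (irrefl G x)) xx

  two-neighbours : ∀ {S} → IsDissociationSet G S → ∀ {x y z} → S x ≡ true → y ≢ z →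
    S y ≡ true → adj G x y ≡ true → S z ≡ true → adj G x z ≡ true → ⊥
  two-neighbours {S} D {x} Sx y≢z Sy xy Sz xz with
    ≤-trans (two-members⇒2≤size (λ k → S k ∧ adj G x k) y≢z (cong₂ _∧_ Sy xy) (cong₂ _∧_ Sz xz))
            (D x Sx)
  ... | s≤s ()

  pair-isDissociationSet : ∀ {y z} → IsDissociationSet G (pair y z)
  pair-isDissociationSet {y} {z} x x∈ with ∈-pair⁻ y z x∈
  ... | inj₁ refl = induced-degree≤1 _ y z λ k k∈ yk → other-than-y k∈ yk
    where
    other-than-y : ∀ {k} → pair y z k ≡ true → adj G y k ≡ true → k ≡ z
    other-than-y k∈ yk with ∈-pair⁻ y z k∈
    ... | inj₁ refl = ⊥-elim (self-loop yk)
    ... | inj₂ z≡k = sym z≡k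
  ... | inj₂ refl = induced-degree≤1 _ z y λ k k∈ zk → other-than-z k∈ zk
    where
    other-than-z : ∀ {k} → pair y z k ≡ true → adj G z k ≡ true → k ≡ y
    other-than-z k∈ zk with ∈-pair⁻ y z k∈
    ... | inj₁ y≡k = sym y≡k
    ... | inj₂ refl = ⊥-elim (self-loop zk)

  triple-isDissociationSet : ∀ {i j k} → adj G i j ≡ false → adj G i k ≡ false →
    IsDissociationSet G (insert i (pair j k))
  triple-isDissociationSet {i} {j} {k} ij ik x x∈ with ∈-insert⁻ i (pair j k) x∈
  ... | inj₁ refl = induced-degree≤1 _ i i λ l l∈ il → ⊥-elim (isolated l∈ il)
    where
    isolated : ∀ {l} → insert i (pair j k) l ≡ true → adj G i l ≡ true → ⊥
    isolated {l} l∈ il with ∈-insert⁻ i (pair j k) l∈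
    ... | inj₁ refl = self-loop il
    ... | inj₂ l∈jk with ∈-pair⁻ j k l∈jk
    ... | inj₁ refl = not-¬ ij il
    ... | inj₂ refl = not-¬ ik il
  ... | inj₂ x∈jk with ∈-pair⁻ j k x∈jk
  ... | inj₁ refl = induced-degree≤1 _ j k λ l l∈ jl → only-k l∈ jl
    where
    only-k : ∀ {l} → insert i (pair j k) l ≡ true → adj G j l ≡ true → l ≡ k
    only-k {l} l∈ jl with ∈-insert⁻ i (pair j k) l∈
    ... | inj₁ refl = ⊥-elim (not-¬ (trans (Graph.sym G j i) ij) jl)
    ... | inj₂ l∈jk with ∈-pair⁻ j k l∈jk
    ... | inj₁ refl = ⊥-elim (self-loop jl)
    ... | inj₂ k≡l = sym k≡l
  ... | inj₂ refl = induced-degree≤1 _ k j λ l l∈ kl → only-j l∈ kl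
    where
    only-j : ∀ {l} → insert i (pair j k) l ≡ true → adj G k l ≡ true → l ≡ j
    only-j {l} l∈ kl with ∈-insert⁻ i (pair j k) l∈
    ... | inj₁ refl = ⊥-elim (not-¬ (trans (Graph.sym G k i) ik) kl)
    ... | inj₂ l∈jk with ∈-pair⁻ j k l∈jk
    ... | inj₁ j≡l = sym j≡l
    ... | inj₂ refl = ⊥-elim (self-loop kl)

  dissociationNumber2⇒isCoMatching : DissociationNumber G 2 → IsCoMatching G
  dissociationNumber2⇒isCoMatching (_ , maximal) {i} {j} {k} i≢j i≢k ij ik with j ≟ k
  ... | yes j≡k = j≡k
  ... | no j≢k with subst (_≤ 2) (size-triple i≢j i≢k j≢k) (maximal _ (triple-isDissociationSet ij ik))
  ...   | s≤s (s≤s ())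

  module _ (coMatching : IsCoMatching G) where
    open CoMatchingProperties G coMatching

    -- Take u ∈ S. Either S ⊆ {u, partner u}, or u has an S-neighbour v and then S ⊆ {u, v}: a third
    -- member would be a second S-neighbour of u, unless it is partner u, which is adjacent to v.
    isCoMatching⇒size≤2 : ∀ S → IsDissociationSet G S → size S ≤ 2
    isCoMatching⇒size≤2 S D with any? (λ u → S u ≟ᵇ true)
    ... | no empty = subst (_≤ 2) (sym (size-empty S (λ k → ¬-not (empty ∘ (k ,_))))) z≤n
    ... | yes (u , Su) with any? (λ v → (S v ∧ adj G u v) ≟ᵇ true)
    ...   | no isolated = size-≤2 S u (partner G u) members
      where
      members : ∀ k → S k ≡ true → u ≡ k ⊎ partner G u ≡ k
      members k Sk with u ≟ k | partner G u ≟ k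
      ... | yes u≡k | _ = inj₁ u≡k
      ... | no _ | yes p≡k = inj₂ p≡k
      ... | no u≢k | no p≢k = ⊥-elim (isolated (k , cong₂ _∧_ Sk (adjacent u≢k (p≢k ∘ sym))))
    ...   | yes (v , Sv∧uv) = size-≤2 S u v members
      where
      Sv = ∧-conicalˡ _ _ Sv∧uv
      uv = ∧-conicalʳ _ _ Sv∧uv
      u≢v : u ≢ v
      u≢v refl = self-loop uv
      members : ∀ k → S k ≡ true → u ≡ k ⊎ v ≡ k
      members k Sk with u ≟ k | v ≟ k
      ... | yes u≡k | _ = inj₁ u≡k
      ... | no _ | yes v≡k = inj₂ v≡k
      ... | no u≢k | no v≢k with partner G u ≟ k
      ...   | no p≢k = ⊥-elim (two-neighbours D Su v≢k Sv uv Sk (adjacent u≢k (p≢k ∘ sym)))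
      ...   | yes refl = ⊥-elim (two-neighbours D Sv u≢k Su vu Sk vk)
        where
        vu : adj G v u ≡ true
        vu = trans (Graph.sym G v u) uv
        vk : adj G v (partner G u) ≡ true
        vk = adjacent v≢k λ pu≡pv → u≢v (begin
          u                           ≡⟨ partner-involutive u ⟨
          partner G (partner G u)     ≡⟨ cong (partner G) pu≡pv ⟩
          partner G (partner G v)     ≡⟨ partner-involutive v ⟩
          v                           ∎)

    isCoMatching⇒dissociationNumber2 : ∀ {y z} → y ≢ z → DissociationNumber G 2
    isCoMatching⇒dissociationNumber2 {y} {z} y≢z =
      (pair y z , pair-isDissociationSet {y} {z} , size-pair y≢z) , isCoMatching⇒size≤2

    isCoMatching⇒connected : 3 ≤ n → Connected G
    isCoMatching⇒connected 3≤n u v with u ≟ v | adj G u v in uv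
    ... | yes refl | _ = here
    ... | no _ | true = step uv here
    ... | no u≢v | false with third-vertex 3≤n u v
    ...   | w , u≢w , v≢w = step (adjacent u≢w w≢pu) (step wv here)
      where
      w≢pu : w ≢ partner G u
      w≢pu w≡pu = v≢w (trans (nonadjacent⇒partner u≢v uv) (sym w≡pu))
      wv : adj G w v ≡ true
      wv = trans (Graph.sym G w v) (adjacent v≢w λ w≡pv → u≢w
             (trans (nonadjacent⇒partner (u≢v ∘ sym) (trans (Graph.sym G v u) uv)) (sym w≡pv)))

-- Cocktail party graphs

CP-nonadjacent⇒same-half : ∀ (i j : Fin n) → adj (CP n) i j ≡ false → toℕ i / 2 ≡ toℕ j / 2
CP-nonadjacent⇒same-half i j ij = ℕ.≡ᵇ⇒≡ (toℕ i / 2) (toℕ j / 2)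
  (Equivalence.from T-≡ (trans (sym (not-involutive _)) (cong not ij)))

-- Vertices with equal halves are told apart by their parities, and there are only two of those.
CP-isCoMatching : ∀ n → IsCoMatching (CP n)
CP-isCoMatching n {i} {j} {k} i≢j i≢k ij ik = toℕ-injective (≡-by-/2-%2
  (trans (sym (CP-nonadjacent⇒same-half i j ij)) (CP-nonadjacent⇒same-half i k ik))
  (third-bit (m%n<n (toℕ i) 2) (m%n<n (toℕ j) 2) (m%n<n (toℕ k) 2)
    (i≢j ∘ toℕ-injective ∘ ≡-by-/2-%2 (CP-nonadjacent⇒same-half i j ij))
    (i≢k ∘ toℕ-injective ∘ ≡-by-/2-%2 (CP-nonadjacent⇒same-half i k ik))))
  where
  third-bit : ∀ {a b c} → a < 2 → b < 2 → c < 2 → a ≢ b → a ≢ c → b ≡ c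
  third-bit (s≤s z≤n) (s≤s z≤n) _ a≢b _ = ⊥-elim (a≢b refl)
  third-bit (s≤s z≤n) (s≤s (s≤s z≤n)) (s≤s z≤n) _ a≢c = ⊥-elim (a≢c refl)
  third-bit (s≤s z≤n) (s≤s (s≤s z≤n)) (s≤s (s≤s z≤n)) _ _ = refl
  third-bit (s≤s (s≤s z≤n)) (s≤s z≤n) (s≤s z≤n) _ _ = refl
  third-bit (s≤s (s≤s z≤n)) (s≤s z≤n) (s≤s (s≤s z≤n)) _ a≢c = ⊥-elim (a≢c refl)
  third-bit (s≤s (s≤s z≤n)) (s≤s (s≤s z≤n)) _ a≢b _ = ⊥-elim (a≢b refl)

CP-nonNeighbour : ∀ k → n ≡ 2 * k → (i : Fin n) → ∃ (NonNeighbour (CP n) i)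
CP-nonNeighbour {n} k n≡2k i = j , i≢j , ij
  where
  -- j is the other vertex of the pair {2q, 2q + 1} containing i.
  x = toℕ i
  q = x / 2
  b′ = 1 ∸ x % 2
  b′<2 : b′ < 2
  b′<2 = s≤s (m∸n≤m 1 (x % 2))
  n≡k*2 : n ≡ k * 2
  n≡k*2 = trans n≡2k (*-comm 2 k)
  y<n : b′ + q * 2 < n
  y<n = subst (b′ + q * 2 <_) (sym n≡k*2)
    (b+q*2<k*2 b′<2 (m<n*o⇒m/o<n {n = k} (subst (x <_) n≡k*2 (toℕ<n i))))
  j = fromℕ< y<n
  i≢j : i ≢ j
  i≢j i≡j = other-bit (m%n<n x 2) (begin
    x % 2                  ≡⟨ cong (λ v → toℕ v % 2) i≡j ⟩
    toℕ j % 2              ≡⟨ cong (_% 2) (toℕ-fromℕ< y<n) ⟩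
    (b′ + q * 2) % 2       ≡⟨ [b+q*2]%2≡b b′ q b′<2 ⟩
    b′                     ∎)
    where
    other-bit : ∀ {b} → b < 2 → b ≢ 1 ∸ b
    other-bit (s≤s z≤n) ()
    other-bit (s≤s (s≤s z≤n)) ()
  ij : adj (CP n) i j ≡ false
  ij rewrite toℕ-fromℕ< y<n | [b+q*2]/2≡q b′ q b′<2 = cong not (dec-true (q ℕ.≟ q) refl)

unmatched-CP : ∀ k → n ≡ 2 * k → unmatched (CP n) ≡ 0
unmatched-CP k n≡2k = all-nonNeighbour⇒unmatched≡0 (CP _) (CP-nonNeighbour k n≡2k)

joinK1-isCoMatching : (G : Graph n) → IsCoMatching G → IsCoMatching (joinK1 G)
joinK1-isCoMatching G coMatching {fz} {fz} i≢j _ _ _ = ⊥-elim (i≢j refl)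
joinK1-isCoMatching G coMatching {fs i} {fs j} {fs k} i≢j i≢k ij ik =
  cong fs (coMatching (i≢j ∘ cong fs) (i≢k ∘ cong fs) ij ik)

L-isCoMatching : ∀ n → IsCoMatching (L n)
L-isCoMatching zero = CP-isCoMatching zero
L-isCoMatching (suc n) = joinK1-isCoMatching (CP n) (CP-isCoMatching n)

unmatched-L : ∀ k → n ≡ suc (2 * k) → unmatched (L n) ≡ 1
unmatched-L k refl = trans (sumFin-suc (2 * k) _)
  (cong₂ _+_ apex-unmatched (size-empty (isUnmatched H ∘ fs) others-matched))
  where
  H = joinK1 (CP (2 * k))
  apex-unmatched : b2n (isUnmatched H fz) ≡ 1
  apex-unmatched = cong b2n (dec-true (_ ≟ _) (adjacent-all⇒partner≡ H λ
    { fz fz≢fz → ⊥-elim (fz≢fz refl)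
    ; (fs _) _ → refl }))
  others-matched : ∀ i → isUnmatched H (fs i) ≡ false
  others-matched i with CP-nonNeighbour k refl i
  ... | j , i≢j , ij = nonNeighbour⇒matched H (fs j , i≢j ∘ suc-injective , ij)

-- Relabelling a co-matching graph

module Relabelling (G : Graph n) (coMatching : IsCoMatching G) where
  open CoMatchingProperties G coMatching

  leader : Fin n → Fin n
  leader i = if lowerEnd G i then i else partner G i

  side : Fin n → ℕ
  side i = if lowerEnd G i then 0 else 1

  below : Fin n → Subset n
  below x k = lowerEnd G k ∧ (toℕ k <ᵇ toℕ x)

  rank : Fin n → ℕ
  rank x = size (below x)

  pairIndex : Fin n → ℕ
  pairIndex i = rank (leader i)

  -- The ends of the non-edge of rank k (ordered by lower ends) get the labels 2k and 2k + 1,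
  -- which form the non-edge of rank k of a cocktail party graph.
  label : Fin n → ℕ
  label i = side i + pairIndex i * 2

  lowerEnd-partner : ∀ {i} → i ≢ partner G i → lowerEnd G (partner G i) ≡ not (lowerEnd G i)
  lowerEnd-partner {i} i≢p rewrite partner-involutive i with <-cmp (toℕ i) (toℕ (partner G i))
  ... | tri< i<p _ p≮i rewrite dec-true (i <?ᶠ partner G i) i<p = dec-false (partner G i <?ᶠ i) p≮i
  ... | tri≈ _ i≡p _ = ⊥-elim (i≢p (toℕ-injective i≡p))
  ... | tri> i≮p _ p<i rewrite dec-false (i <?ᶠ partner G i) i≮p = dec-true (partner G i <?ᶠ i) p<i

  leader-lowerEnd : ∀ {i} → i ≢ partner G i → lowerEnd G (leader i) ≡ true
  leader-lowerEnd {i} i≢p with lowerEnd G i in low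
  ... | true = low
  ... | false = trans (lowerEnd-partner i≢p) (cong not low)

  leader-partner : ∀ {i} → i ≢ partner G i → leader (partner G i) ≡ leader i
  leader-partner {i} i≢p with lowerEnd G i in low | lowerEnd G (partner G i) in lowP
  ... | true | false = partner-involutive i
  ... | false | true = refl
  ... | true | true with () ← trans (sym lowP) (trans (lowerEnd-partner i≢p) (cong not low))
  ... | false | false with () ← trans (sym lowP) (trans (lowerEnd-partner i≢p) (cong not low))

  side-partner : ∀ {i} → i ≢ partner G i → side i ≢ side (partner G i)
  side-partner {i} i≢p rewrite lowerEnd-partner i≢p with lowerEnd G i
  ... | true = λ ()
  ... | false = λ ()

  leader∈pair : ∀ i → leader i ≡ i ⊎ leader i ≡ partner G i
  leader∈pair i with lowerEnd G i
  ... | true = inj₁ refl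
  ... | false = inj₂ refl

  same-leader : ∀ {i j} → leader i ≡ leader j → j ≡ i ⊎ j ≡ partner G i
  same-leader {i} {j} ℓi≡ℓj with leader∈pair i | leader∈pair j
  ... | inj₁ ℓi≡i | inj₁ ℓj≡j = inj₁ (trans (sym ℓj≡j) (trans (sym ℓi≡ℓj) ℓi≡i))
  ... | inj₁ ℓi≡i | inj₂ ℓj≡pj = inj₂ (trans (sym (partner-involutive j))
          (cong (partner G) (trans (sym ℓj≡pj) (trans (sym ℓi≡ℓj) ℓi≡i))))
  ... | inj₂ ℓi≡pi | inj₁ ℓj≡j = inj₂ (trans (sym ℓj≡j) (trans (sym ℓi≡ℓj) ℓi≡pi))
  ... | inj₂ ℓi≡pi | inj₂ ℓj≡pj = inj₁ (trans (sym (partner-involutive j))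
          (trans (cong (partner G) (trans (sym ℓj≡pj) (trans (sym ℓi≡ℓj) ℓi≡pi))) (partner-involutive i)))

  rank<size : ∀ {x} {S : Subset n} → lowerEnd G x ≡ true → S x ≡ true → below x ⊆ S → rank x < size S
  rank<size {x} {S} lowX Sx below⊆S = ≤-trans (≤-reflexive (sym (size-insert x (below x) x∉below)))
    (size-mono {S = insert x (below x)} insert⊆)
    where
    x∉below : below x x ≡ false
    x∉below = trans (cong (lowerEnd G x ∧_) (dec-false (x <?ᶠ x) (<-irrefl refl))) (∧-zeroʳ _)
    insert⊆ : insert x (below x) ⊆ S
    insert⊆ k k∈ with ∈-insert⁻ x (below x) k∈
    ... | inj₁ refl = Sx
    ... | inj₂ k∈below = below⊆S k k∈below

  rank-< : ∀ {x y} → lowerEnd G x ≡ true → toℕ x < toℕ y → rank x < rank y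
  rank-< {x} {y} lowX x<y = rank<size lowX (cong₂ _∧_ lowX (dec-true (x <?ᶠ y) x<y)) below⊆
    where
    below⊆ : below x ⊆ below y
    below⊆ k k∈ = cong₂ _∧_ (∧-conicalˡ _ _ k∈)
      (dec-true (k <?ᶠ y) (<-trans (<ᵇ-true⇒< (∧-conicalʳ _ _ k∈)) x<y))

  rank<nonEdges : ∀ {x} → lowerEnd G x ≡ true → rank x < nonEdges G
  rank<nonEdges {x} lowX = subst (rank x <_) (sym nonEdges≡size-lowerEnd)
    (rank<size lowX lowX (λ k → ∧-conicalˡ _ _))

  rank-injective : ∀ {x y} → lowerEnd G x ≡ true → lowerEnd G y ≡ true → rank x ≡ rank y → x ≡ y
  rank-injective {x} {y} lowX lowY rx≡ry with <-cmp (toℕ x) (toℕ y)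
  ... | tri< x<y _ _ = ⊥-elim (<-irrefl rx≡ry (rank-< lowX x<y))
  ... | tri≈ _ x≡y _ = toℕ-injective x≡y
  ... | tri> _ _ y<x = ⊥-elim (<-irrefl (sym rx≡ry) (rank-< lowY y<x))

  same-pairIndex : ∀ {i j} → i ≢ partner G i → j ≢ partner G j →
    pairIndex i ≡ pairIndex j → j ≡ i ⊎ j ≡ partner G i
  same-pairIndex i≢pi j≢pj = same-leader ∘ rank-injective (leader-lowerEnd i≢pi) (leader-lowerEnd j≢pj)

  -- Phrased with ℕ._≟_ because does (x ≟ y) is definitionally x ≡ᵇ y, the test defining CP.
  adj-by-pairIndex : ∀ {i j} → i ≢ partner G i → j ≢ partner G j →
    adj G i j ≡ not (does (pairIndex i ℕ.≟ pairIndex j))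
  adj-by-pairIndex {i} {j} i≢pi j≢pj with adj G i j in ij
  ... | true = cong not (sym (dec-false (_ ℕ.≟ _) (nonadjacent-within ∘ same-pairIndex i≢pi j≢pj)))
    where
    nonadjacent-within : j ≡ i ⊎ j ≡ partner G i → ⊥
    nonadjacent-within (inj₁ refl) with () ← trans (sym ij) (irrefl G i)
    nonadjacent-within (inj₂ refl) with () ← trans (sym ij) (partner-nonadjacent G i)
  ... | false = cong not (sym (dec-true (_ ℕ.≟ _) (cong rank same-leader′)))
    where
    same-leader′ : leader i ≡ leader j
    same-leader′ with i ≟ j
    ... | yes refl = refl
    ... | no i≢j = trans (sym (leader-partner i≢pi)) (cong leader (sym (nonadjacent⇒partner i≢j ij)))

  side<2 : ∀ i → side i < 2
  side<2 i with lowerEnd G i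
  ... | true = s≤s z≤n
  ... | false = s≤s (s≤s z≤n)

  label/2 : ∀ i → label i / 2 ≡ pairIndex i
  label/2 i = [b+q*2]/2≡q (side i) (pairIndex i) (side<2 i)

  label-injective : ∀ {i j} → i ≢ partner G i → j ≢ partner G j → label i ≡ label j → i ≡ j
  label-injective {i} {j} i≢pi j≢pj li≡lj
    with same-pairIndex i≢pi j≢pj (trans (sym (label/2 i)) (trans (cong (_/ 2) li≡lj) (label/2 j)))
  ... | inj₁ j≡i = sym j≡i
  ... | inj₂ refl = ⊥-elim (side-partner i≢pi (begin
    side i                    ≡⟨ label%2 i ⟨
    label i % 2               ≡⟨ cong (_% 2) li≡lj ⟩
    label (partner G i) % 2   ≡⟨ label%2 (partner G i) ⟩
    side (partner G i)        ∎))
    where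
    label%2 : ∀ k → label k % 2 ≡ side k
    label%2 k = [b+q*2]%2≡b (side k) (pairIndex k) (side<2 k)
  
  label<nonEdges*2 : ∀ {i} → i ≢ partner G i → label i < nonEdges G * 2
  label<nonEdges*2 {i} i≢pi = b+q*2<k*2 (side<2 i) (rank<nonEdges (leader-lowerEnd i≢pi))

  module _ {m} (room : nonEdges G * 2 ≤ m) where

    relabel : ∀ {i} → i ≢ partner G i → Fin m
    relabel i≢pi = fromℕ< (≤-trans (label<nonEdges*2 i≢pi) room)

    toℕ-relabel : ∀ {i} (i≢pi : i ≢ partner G i) → toℕ (relabel i≢pi) ≡ label i
    toℕ-relabel i≢pi = toℕ-fromℕ< (≤-trans (label<nonEdges*2 i≢pi) room)

    relabel-injective : ∀ {i j} (i≢pi : i ≢ partner G i) (j≢pj : j ≢ partner G j) →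
      relabel i≢pi ≡ relabel j≢pj → i ≡ j
    relabel-injective i≢pi j≢pj e = label-injective i≢pi j≢pj
      (trans (sym (toℕ-relabel i≢pi)) (trans (cong toℕ e) (toℕ-relabel j≢pj)))

    relabel-adj : ∀ {i j} (i≢pi : i ≢ partner G i) (j≢pj : j ≢ partner G j) →
      adj G i j ≡ adj (CP m) (relabel i≢pi) (relabel j≢pj)
    relabel-adj i≢pi j≢pj = trans (adj-by-pairIndex i≢pi j≢pj)
      (cong₂ (λ a b → not (does (a ℕ.≟ b))) (sym (relabel/2 i≢pi)) (sym (relabel/2 j≢pj)))
      where
      relabel/2 : ∀ {i} (i≢pi : i ≢ partner G i) → toℕ (relabel i≢pi) / 2 ≡ pairIndex i
      relabel/2 {i} i≢pi = trans (cong (_/ 2) (toℕ-relabel i≢pi)) (label/2 i)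

injective⇒surjective : (f : Fin n → Fin n) → (∀ {i j} → f i ≡ f j → i ≡ j) →
  ∀ y → ∃ λ x → f x ≡ y
injective⇒surjective {zero} f _ ()
injective⇒surjective {suc n} f f-injective y with any? (λ x → f x ≟ y)
... | yes found = found
... | no missed = ⊥-elim (<-irrefl refl (injective⇒≤ {f = squeeze} squeeze-injective))
  where
  squeeze : Fin (suc n) → Fin n
  squeeze x = punchOut {i = y} {j = f x} (λ y≡fx → missed (x , sym y≡fx))
  squeeze-injective : ∀ {x z} → squeeze x ≡ squeeze z → x ≡ z
  squeeze-injective {x} {z} = f-injective ∘ punchOut-injective {i = y} _ _

injective⇒≅ : (G H : Graph n) (f : Fin n → Fin n) → (∀ {i j} → f i ≡ f j → i ≡ j) →
  (∀ i j → adj G i j ≡ adj H (f i) (f j)) → G ≅ H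
injective⇒≅ G H f f-injective f-adj = mk↔ₛ′ f f⁻¹ inverseˡ inverseʳ , f-adj
  where
  f⁻¹ = proj₁ ∘ injective⇒surjective f f-injective
  inverseˡ = proj₂ ∘ injective⇒surjective f f-injective
  inverseʳ = λ x → f-injective (inverseˡ (f x))

isCoMatching⇒≅CP : (G : Graph n) → IsCoMatching G → unmatched G ≡ 0 → G ≅ CP n
isCoMatching⇒≅CP {n} G coMatching none =
  injective⇒≅ G (CP n) f (relabel-injective room (matched _) (matched _))
    (λ i j → relabel-adj room (matched i) (matched j))
  where
  open Relabelling G coMatching

  matched : ∀ i → i ≢ partner G i
  matched i i≡pi with subst (1 ≤_) none (partner≡⇒1≤unmatched G (sym i≡pi))
  ... | ()

  room : nonEdges G * 2 ≤ n
  room = ≤-reflexive (trans (cong (_+ nonEdges G * 2) (sym none))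
    (CoMatchingProperties.unmatched+nonEdges*2 G coMatching))

  f : Fin n → Fin n
  f i = relabel room (matched i)

isCoMatching⇒≅L : (G : Graph n) → IsCoMatching G → unmatched G ≡ 1 → G ≅ L n
isCoMatching⇒≅L {zero} G _ ()
isCoMatching⇒≅L {suc d} G coMatching one with 1≤unmatched⇒partner≡ G (≤-reflexive (sym one))
... | c , pc≡c = injective⇒≅ G (L (suc d)) f f-injective f-adj
  where
  open CoMatchingProperties G coMatching
  open Relabelling G coMatching

  matched : ∀ {i} → i ≢ c → i ≢ partner G i
  matched i≢c i≡pi = i≢c (unmatched≡1⇒unique G one (sym i≡pi) pc≡c)

  room : nonEdges G * 2 ≤ d
  room = ≤-reflexive (ℕ.suc-injective (trans (cong (_+ nonEdges G * 2) (sym one)) unmatched+nonEdges*2))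

  embed : ∀ i → Dec (i ≡ c) → Fin (suc d)
  embed i (yes _) = fz
  embed i (no i≢c) = fs (relabel room (matched i≢c))

  f : Fin (suc d) → Fin (suc d)
  f i = embed i (i ≟ c)

  embed-injective : ∀ {i j} (i≟c : Dec (i ≡ c)) (j≟c : Dec (j ≡ c)) →
    embed i i≟c ≡ embed j j≟c → i ≡ j
  embed-injective (yes i≡c) (yes j≡c) _ = trans i≡c (sym j≡c)
  embed-injective (no i≢c) (no j≢c) e = relabel-injective room (matched i≢c) (matched j≢c) (suc-injective e)

  f-injective : ∀ {i j} → f i ≡ f j → i ≡ j
  f-injective {i} {j} = embed-injective (i ≟ c) (j ≟ c)

  centre-adjacent : ∀ {j} → j ≢ c → adj G c j ≡ true
  centre-adjacent j≢c = adjacent (j≢c ∘ sym) (λ j≡pc → j≢c (trans j≡pc pc≡c))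

  embed-adj : ∀ i j (i≟c : Dec (i ≡ c)) (j≟c : Dec (j ≡ c)) →
    adj G i j ≡ adj (L (suc d)) (embed i i≟c) (embed j j≟c)
  embed-adj i j (yes refl) (yes refl) = irrefl G c
  embed-adj i j (yes refl) (no j≢c) = centre-adjacent j≢c
  embed-adj i j (no i≢c) (yes refl) = trans (Graph.sym G i c) (centre-adjacent i≢c)
  embed-adj i j (no i≢c) (no j≢c) = relabel-adj room (matched i≢c) (matched j≢c)

  f-adj : ∀ i j → adj G i j ≡ adj (L (suc d)) (f i) (f j)
  f-adj i j = embed-adj i j (i ≟ c) (j ≟ c)

-- Fewest edges

fewer-nonEdges : ∀ {u m u′ m′} → u + m * 2 ≡ u′ + m′ * 2 → u′ < 2 → m ≤ m′
fewer-nonEdges {u} {m} {u′} {m′} vertices u′<2 with m ℕ.≤? m′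
... | yes m≤m′ = m≤m′
... | no m≰m′ =
  ⊥-elim (<-irrefl (sym vertices) (≤-trans (b+q*2<k*2 u′<2 (≰⇒> m≰m′)) (m≤n+m (m * 2) u)))

-- e, m and u count the edges, non-edges and unmatched vertices of two co-matching graphs on the
-- same vertex set.
module _ {e m u e′ m′ u′ : ℕ} (pairs : e + m ≡ e′ + m′) (vertices : u + m * 2 ≡ u′ + m′ * 2) where

  fewest-edges : u′ < 2 → e′ ≤ e
  fewest-edges u′<2 =
    +-cancelʳ-≤ m′ e′ e (subst (_≤ e + m′) pairs (+-monoʳ-≤ e (fewer-nonEdges vertices u′<2)))

  same-edges⇒same-unmatched : e ≡ e′ → u ≡ u′
  same-edges⇒same-unmatched refl =
    +-cancelʳ-≡ (m * 2) u u′ (subst (λ x → u + m * 2 ≡ u′ + x * 2) (sym (+-cancelˡ-≡ e m m′ pairs)) vertices)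

isCoMatching⇒uniqueMinimizer : (H : Graph n) → 3 ≤ n → IsCoMatching H → unmatched H < 2 →
  (∀ G → IsCoMatching G → unmatched G ≡ unmatched H → G ≅ H) → UniqueMinimizer H
isCoMatching⇒uniqueMinimizer H 3≤n@(s≤s (s≤s (s≤s _))) coMatchingH unmatchedH<2 rigid =
    isCoMatching⇒connected H coMatchingH 3≤n
  , isCoMatching⇒dissociationNumber2 H coMatchingH {fz} {fs fz} (λ ())
  , λ G _ τG≡2 → let coMatchingG = dissociationNumber2⇒isCoMatching G τG≡2
                     pairs = trans (edges+nonEdges G) (sym (edges+nonEdges H))
                     vertices = trans (CoMatchingProperties.unmatched+nonEdges*2 G coMatchingG)
                                      (sym (CoMatchingProperties.unmatched+nonEdges*2 H coMatchingH))
                 in fewest-edges pairs vertices unmatchedH<2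
                  , λ eq → rigid G coMatchingG (same-edges⇒same-unmatched pairs vertices eq)

proposition4p1 : ∀ (n : ℕ) → 3 ≤ n →
    (∀ k → n ≡ 2 * k → UniqueMinimizer (CP n))
    × (∀ k → n ≡ suc (2 * k) → UniqueMinimizer (L n))
proposition4p1 n 3≤n =
    (λ k n≡2k → isCoMatching⇒uniqueMinimizer (CP n) 3≤n (CP-isCoMatching n)
       (subst (_< 2) (sym (unmatched-CP k n≡2k)) (s≤s z≤n))
       (λ G coMatching u≡ → isCoMatching⇒≅CP G coMatching (trans u≡ (unmatched-CP k n≡2k))))
  , (λ k n≡1+2k → isCoMatching⇒uniqueMinimizer (L n) 3≤n (L-isCoMatching n)
       (subst (_< 2) (sym (unmatched-L k n≡1+2k)) (s≤s (s≤s z≤n)))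
       (λ G coMatching u≡ → isCoMatching⇒≅L G coMatching (trans u≡ (unmatched-L k n≡1+2k))))
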